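{- Let $\mathcal M^0=\{K_{\widehat i}\,g: g\in G_{d,k},\ i\in[\![d]\!]\}$ be the set of right cosets of the subgroups $K_{\widehat i}$ in $G_{d,k}$. For $v=K_{\widehat i}\,g\in\mathcal M^0$ let $\mathcal A_v=\{g'\in G_{d,k}:K_{\widehat i}\,g=K_{\widehat i}\,g'\}$. Then the nerve complex $\mathcal N((\mathcal A_v)_{v\in\mathcal M^0})$ is a $d$-dimensional simplicial complex isomorphic to $T_{d,k}$.
   Context: $G_{d,k}=\langle\alpha_0,\dots,\alpha_d\mid\alpha_i^k=e,\ 0\le i\le d\rangle$ ($d,k\ge1$), $[\![d]\!]=\{0,\dots,d\}$. For $J\subseteq[\![d]\!]$, $K_J=\langle\alpha_j:j\in J\rangle$ and $\widehat i=[\![d]\!]\setminus\{i\}$, so $K_{\widehat i}=\langle\alpha_j:j\ne i\rangle$. The nerve complex of a family $(\mathcal A_v)_{v\in I}$ of nonempty sets is the simplicial complex on vertex set $I$ whose cells are the finite $\sigma\subseteq I$ with $\bigcap_{v\in\sigma}\mathcal A_v\ne\emptyset$. The arboreal complex $T_{d,k}$: let $B_0$ be a single $d$-cell with its faces; $B_{n+1}$ is obtained from $B_n$ by attaching, to each $(d-1)$-cell of $B_n$ contained in exactly one $d$-cell of $B_n$, $k-1$ new $d$-cells each using a new vertex; $T_{d,k}=\bigcup_nB_n$. -}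

module Defs where

open import Data.Nat using (ℕ; suc; _∸_; _≤_)
open import Data.Fin using (Fin; _≟_)
open import Data.Bool using (Bool; true; false; not)
open import Data.Maybe using (Maybe; just; nothing)
open import Data.Unit using (⊤)
open import Data.Product using (Σ; ∃; _×_; _,_; proj₁; proj₂)
open import Data.List using (List; []; _∷_; _++_; replicate; map; reverse; length)
open import Data.List.Relation.Unary.All using (All)
open import Data.List.Relation.Unary.AllPairs using (AllPairs)
open import Relation.Nullary using (¬_; yes; no)
open import Relation.Nullary.Decidable using (False)
open import Relation.Binary.PropositionalEquality using (_≡_)

module _ (d k : ℕ) where

  -- The group G_{d,k} = ⟨ α_0 … α_d ∣ α_i^k = e ⟩, given by its
  -- presentation: words in the letters α_i^{±1} modulo the smallest
  -- congruence containing free cancellation and the relators α_i^k.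

  -- (i , true) is α_i, (i , false) is α_i⁻¹
  Letter : Set
  Letter = Fin (suc d) × Bool

  invL : Letter → Letter
  invL (i , b) = (i , not b)

  Word : Set
  Word = List Letter

  invW : Word → Word
  invW w = reverse (map invL w)

  -- equality in G_{d,k}; group product is _++_, identity is []
  data _≈G_ : Word → Word → Set where
    ≈-refl   : ∀ {u} → u ≈G u
    ≈-sym    : ∀ {u v} → u ≈G v → v ≈G u
    ≈-trans  : ∀ {u v w} → u ≈G v → v ≈G w → u ≈G w
    ≈-cancel : ∀ u v x → (u ++ x ∷ invL x ∷ v) ≈G (u ++ v)
    ≈-power  : ∀ u v (i : Fin (suc d)) → (u ++ replicate k (i , true) ++ v) ≈G (u ++ v)

  -- membership in K_{î} = ⟨ α_j : j ≠ i ⟩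
  InK : Fin (suc d) → Word → Set
  InK i g = Σ Word λ w → All (λ x → ¬ (proj₁ x ≡ i)) w × (w ≈G g)

  InCoset : Fin (suc d) → Word → Word → Set
  InCoset i g x = Σ Word λ h → InK i h × (x ≈G (h ++ g))

  SameCoset : Fin (suc d) → Word → Word → Set
  SameCoset i g g' = ∀ x → (InCoset i g x → InCoset i g' x) × (InCoset i g' x → InCoset i g x)

  M0 : Set
  M0 = Fin (suc d) × Word

  _≈M_ : M0 → M0 → Set
  (i , g) ≈M (j , g') = (i ≡ j) × SameCoset i g g'

  A : M0 → Word → Set
  A (i , g) g' = SameCoset i g g'

  NerveCell : List M0 → Set
  NerveCell σ = Σ Word λ g' → All (λ v → A v g') σ

  DistinctM : List M0 → Set
  DistinctM σ = AllPairs (λ u v → ¬ (u ≈M v)) σ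

  NerveIsDDim : Set
  NerveIsDDim =
    (∀ σ → NerveCell σ → DistinctM σ → length σ ≤ suc d) ×
    (Σ (List M0) λ σ → NerveCell σ × DistinctM σ × (length σ ≡ suc d))

  -- A d-cell is either the initial cell of B_0, or a cell attached to
  -- a free (d-1)-face of an earlier d-cell c: the face opposite the
  -- vertex at position j of c, together with a copy index a among the
  -- k-1 new cells; the new vertex takes position j.  The index m
  -- records the position of the newest vertex (nothing for B_0): the
  -- faces of a cell that lie in exactly one d-cell at the stage it was
  -- created are exactly those opposite a position j ≠ m.

  Allowed : Maybe (Fin (suc d)) → Fin (suc d) → Set
  Allowed nothing  j = ⊤
  Allowed (just i) j = False (i ≟ j)

  data Cell : Maybe (Fin (suc d)) → Set where
    base : Cell nothing
    grow : ∀ {m} → Cell m → (j : Fin (suc d)) → Allowed m j → Fin (k ∸ 1) → Cell (just j)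

  -- vertices of T_{d,k}: the vertices of B_0, and the new vertex of
  -- each attached cell (identified by that attached cell)
  data TV : Set where
    root : Fin (suc d) → TV
    new  : ∀ {m} → Cell m → (j : Fin (suc d)) → Allowed m j → Fin (k ∸ 1) → TV

  vertexAt : ∀ {m} → Cell m → Fin (suc d) → TV
  vertexAt base p = root p
  vertexAt (grow c j ok a) p with p ≟ j
  ... | yes _ = new c j ok a
  ... | no  _ = vertexAt c p

  TCell : List TV → Set
  TCell σ = Σ (Maybe (Fin (suc d))) λ m → Σ (Cell m) λ c →
            All (λ v → Σ (Fin (suc d)) λ p → vertexAt c p ≡ v) σ

  record NerveIsoT : Set where
    field
      to       : M0 → TV
      from     : TV → M0
      to-resp  : ∀ {u v} → u ≈M v → to u ≡ to v
      to-from  : ∀ t → to (from t) ≡ t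
      from-to  : ∀ v → from (to v) ≈M v
      cells-to   : ∀ σ → NerveCell σ → TCell (map to σ)
      cells-from : ∀ σ → TCell (map to σ) → NerveCell σ

-- G_{d,k} is the free product of d+1 cyclic groups of order k, so every element has a
-- unique reduced word α_{j₁}^{e₁} ⋯ α_{jᵣ}^{eᵣ} (consecutive jₛ distinct, 0 < eₛ < k).
-- These reduced words are exactly the d-cells of T_{d,k}: prepending a syllable
-- α_j^{a+1} is attaching one of the k-1 new cells across the face opposite position j.
-- Uniqueness of reduced words is proved by letting G act on them by left multiplication.
-- A right coset K_î g is determined by the suffix of the reduced word of g starting at
-- its first α_i-syllable, and that suffix names the vertex at position i of the cell g.
-- Hence the cosets containing a given g are the vertices of the cell g, which makes the
-- nerve isomorphic to T_{d,k}; since g lies in exactly one coset of each type, nerve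
-- cells have at most d+1 vertices.

module Submission where

open import Defs
open import Data.Nat using (ℕ; zero; suc; _+_; _*_; _≤_; _%_; NonZero)
open import Data.Nat.DivMod
  using (_mod_; _/_; m%n<n; m%n%n≡m%n; %-distribˡ-+; [m+n]%n≡m%n; m<n⇒m%n≡m; m≡m%n+[m/n]*n)
open import Data.Nat.Properties using (+-assoc; +-comm; +-identityʳ)
open import Data.Fin using (Fin; zero; suc; toℕ; _≟_)
open import Data.Fin.Properties using (toℕ-injective; toℕ-fromℕ<; toℕ<n; injective⇒≤)
open import Data.Bool using (Bool; true; false)
open import Data.Bool.Properties using (T-irrelevant)
open import Data.Maybe using (Maybe; just; nothing)
open import Data.Unit using (tt)
open import Data.Empty using (⊥-elim)
open import Data.Product using (Σ; _×_; _,_; proj₁; proj₂)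
open import Data.Product.Properties using (,-injective)
open import Data.List using (List; []; _∷_; _++_; [_]; replicate; map; reverse; length; lookup; allFin)
open import Data.List.Properties using (++-assoc; ++-identityʳ; unfold-reverse; length-map; length-tabulate)
open import Data.List.Membership.Propositional.Properties using (∈-lookup)
open import Data.List.Relation.Unary.All as All using (All; []; _∷_)
import Data.List.Relation.Unary.All.Properties as All
open import Data.List.Relation.Unary.AllPairs as AllPairs using ([]; _∷_)
import Data.List.Relation.Unary.AllPairs.Properties as AllPairs
open import Data.List.Relation.Unary.Unique.Propositional using (Unique)
open import Data.List.Relation.Unary.Unique.Propositional.Properties using (allFin⁺)
open import Function.Definitions using (Injective)
open import Level using (0ℓ)
open import Relation.Binary.Bundles using (Setoid)
import Relation.Binary.Reasoning.Setoid as SetoidReasoning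
open import Relation.Nullary using (¬_; Dec)
open import Relation.Nullary.Decidable using (yes; no; fromWitnessFalse; toWitnessFalse)
open import Relation.Binary.PropositionalEquality
  using (_≡_; refl; sym; trans; cong; subst; subst₂; module ≡-Reasoning)

replicate-+ : ∀ {A : Set} m n (x : A) → replicate (m + n) x ≡ replicate m x ++ replicate n x
replicate-+ zero    n x = refl
replicate-+ (suc m) n x = cong (x ∷_) (replicate-+ m n x)

lookup-injective : ∀ {A : Set} {xs : List A} → Unique xs → Injective _≡_ _≡_ (lookup xs)
lookup-injective (_  ∷ _) {zero}  {zero}  _  = refl
lookup-injective (px ∷ _) {zero}  {suc j} eq = ⊥-elim (All.lookup px (∈-lookup j) eq)
lookup-injective (px ∷ _) {suc i} {zero}  eq = ⊥-elim (All.lookup px (∈-lookup i) (sym eq))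
lookup-injective (_  ∷ u) {suc i} {suc j} eq = cong suc (lookup-injective u eq)

All-reverse⁺ : ∀ {A : Set} {P : A → Set} {xs : List A} → All P xs → All P (reverse xs)
All-reverse⁺ []                        = []
All-reverse⁺ {P = P} {x ∷ xs} (px ∷ pxs) =
  subst (All P) (sym (unfold-reverse x xs)) (All.++⁺ (All-reverse⁺ pxs) (px ∷ []))

Unique⇒length≤ : ∀ {n} {xs : List (Fin n)} → Unique xs → length xs ≤ n
Unique⇒length≤ u = injective⇒≤ (lookup-injective u)

module Presentation (d k : ℕ) where

  infix 4 _≈_
  _≈_ : Word d k → Word d k → Set
  _≈_ = _≈G_ d k

  Avoids : Fin (suc d) → Word d k → Set
  Avoids i = All (λ x → ¬ (proj₁ x ≡ i))

  ≡⇒≈ : ∀ {u v} → u ≡ v → u ≈ v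
  ≡⇒≈ refl = ≈-refl

  setoid : Setoid 0ℓ 0ℓ
  setoid = record
    { Carrier       = Word d k
    ; _≈_           = _≈_
    ; isEquivalence = record { refl = ≈-refl ; sym = ≈-sym ; trans = ≈-trans }
    }

  module ≈-Reasoning = SetoidReasoning setoid

  ++-congˡ : ∀ a {u v} → u ≈ v → a ++ u ≈ a ++ v
  ++-congˡ a ≈-refl          = ≈-refl
  ++-congˡ a (≈-sym p)       = ≈-sym (++-congˡ a p)
  ++-congˡ a (≈-trans p q)   = ≈-trans (++-congˡ a p) (++-congˡ a q)
  ++-congˡ a (≈-cancel u v x) =
    subst₂ _≈_ (++-assoc a u _) (++-assoc a u v) (≈-cancel (a ++ u) v x)
  ++-congˡ a (≈-power u v i)  =
    subst₂ _≈_ (++-assoc a u _) (++-assoc a u v) (≈-power (a ++ u) v i)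

  ++-congʳ : ∀ b {u v} → u ≈ v → u ++ b ≈ v ++ b
  ++-congʳ b ≈-refl          = ≈-refl
  ++-congʳ b (≈-sym p)       = ≈-sym (++-congʳ b p)
  ++-congʳ b (≈-trans p q)   = ≈-trans (++-congʳ b p) (++-congʳ b q)
  ++-congʳ b (≈-cancel u v x) =
    subst₂ _≈_ (sym (++-assoc u (x ∷ invL d k x ∷ v) b)) (sym (++-assoc u v b))
      (≈-cancel u (v ++ b) x)
  ++-congʳ b (≈-power u v i)  =
    subst₂ _≈_
      (sym (trans (++-assoc u (replicate k (i , true) ++ v) b)
                  (cong (u ++_) (++-assoc (replicate k (i , true)) v b))))
      (sym (++-assoc u v b))
      (≈-power u (v ++ b) i)

  invL-involutive : ∀ x → invL d k (invL d k x) ≡ x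
  invL-involutive (i , true)  = refl
  invL-involutive (i , false) = refl

  invW-inverseˡ : ∀ p → invW d k p ++ p ≈ []
  invW-inverseˡ []      = ≈-refl
  invW-inverseˡ (x ∷ p) = ≈-trans (≡⇒≈ reassoc) (≈-trans cancel (invW-inverseˡ p))
    where
      p⁻¹ = invW d k p
      x⁻¹ = invL d k x
      reassoc : invW d k (x ∷ p) ++ x ∷ p ≡ p⁻¹ ++ x⁻¹ ∷ x ∷ p
      reassoc = trans (cong (_++ (x ∷ p)) (unfold-reverse x⁻¹ (map (invL d k) p)))
                      (++-assoc p⁻¹ [ x⁻¹ ] (x ∷ p))
      cancel : p⁻¹ ++ x⁻¹ ∷ x ∷ p ≈ p⁻¹ ++ p
      cancel = subst (λ z → p⁻¹ ++ x⁻¹ ∷ z ∷ p ≈ p⁻¹ ++ p) (invL-involutive x)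
                     (≈-cancel p⁻¹ p x⁻¹)

  Avoids-invW : ∀ {i p} → Avoids i p → Avoids i (invW d k p)
  Avoids-invW ps = All-reverse⁺ (All.map⁺ ps)

  ≈-rebase : ∀ {g g′ s} p p′ → g ≈ p ++ s → g′ ≈ p′ ++ s → g ≈ (p ++ invW d k p′) ++ g′
  ≈-rebase {g} {g′} {s} p p′ g≈ps g′≈p′s = begin
    g                          ≈⟨ g≈ps ⟩
    p ++ s                     ≈⟨ ++-congˡ p (++-congʳ s (invW-inverseˡ p′)) ⟨
    p ++ (q ++ p′) ++ s        ≡⟨ cong (p ++_) (++-assoc q p′ s) ⟩
    p ++ q ++ p′ ++ s          ≈⟨ ++-congˡ p (++-congˡ q g′≈p′s) ⟨
    p ++ q ++ g′               ≡⟨ ++-assoc p q g′ ⟨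
    (p ++ q) ++ g′             ∎
    where
      open ≈-Reasoning
      q = invW d k p′

  replicate-*-≈[] : ∀ q j → replicate (q * k) (j , true) ≈ []
  replicate-*-≈[] zero    j = ≈-refl
  replicate-*-≈[] (suc q) j =
    ≈-trans (≡⇒≈ (replicate-+ k (q * k) (j , true)))
      (≈-trans (≈-power [] _ j) (replicate-*-≈[] q j))

  module _ .{{_ : NonZero k}} where

    replicate-% : ∀ m j → replicate m (j , true) ≈ replicate (m % k) (j , true)
    replicate-% m j =
      ≈-trans (≡⇒≈ division)
        (≈-trans (++-congˡ αʳ (replicate-*-≈[] (m / k) j)) (≡⇒≈ (++-identityʳ αʳ)))
      where
        αʳ = replicate (m % k) (j , true)
        division : replicate m (j , true) ≡ αʳ ++ replicate (m / k * k) (j , true)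
        division = trans (cong (λ t → replicate t (j , true)) (m≡m%n+[m/n]*n m k))
                         (replicate-+ (m % k) _ _)

module NormalForms (d n : ℕ) where

  k : ℕ
  k = suc n

  open Presentation d k

  NormalForm : Set
  NormalForm = Σ (Maybe (Fin (suc d))) (Cell d k)

  identity : NormalForm
  identity = nothing , base

  cellWord : ∀ {m} → Cell d k m → Word d k
  cellWord base            = []
  cellWord (grow c j _ a) = replicate (suc (toℕ a)) (j , true) ++ cellWord c

  word : NormalForm → Word d k
  word (_ , c) = cellWord c

  power : Fin (suc d) → Fin k → Word d k
  power j e = replicate (toℕ e) (j , true)

  shift : ℕ → Fin k → Fin k
  shift t e = (t + toℕ e) mod k

  toℕ-shift : ∀ t e → toℕ (shift t e) ≡ (t + toℕ e) % k
  toℕ-shift t e = toℕ-fromℕ< (m%n<n (t + toℕ e) k)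

  toℕ-%k : ∀ (e : Fin k) → toℕ e % k ≡ toℕ e
  toℕ-%k e = m<n⇒m%n≡m (toℕ<n e)

  shift-+ : ∀ a b e → shift a (shift b e) ≡ shift (a + b) e
  shift-+ a b e = toℕ-injective (begin
    toℕ (shift a (shift b e))           ≡⟨ toℕ-shift a _ ⟩
    (a + toℕ (shift b e)) % k           ≡⟨ cong (λ x → (a + x) % k) (toℕ-shift b e) ⟩
    (a + (b + toℕ e) % k) % k           ≡⟨ %-distribˡ-+ a _ k ⟩
    (a % k + (b + toℕ e) % k % k) % k   ≡⟨ cong (λ x → (a % k + x) % k) (m%n%n≡m%n (b + toℕ e) k) ⟩
    (a % k + (b + toℕ e) % k) % k       ≡⟨ %-distribˡ-+ a _ k ⟨
    (a + (b + toℕ e)) % k               ≡⟨ cong (_% k) (+-assoc a b _) ⟨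
    (a + b + toℕ e) % k                 ≡⟨ toℕ-shift (a + b) e ⟨
    toℕ (shift (a + b) e)               ∎)
    where open ≡-Reasoning

  shift-0 : ∀ e → shift 0 e ≡ e
  shift-0 e = toℕ-injective (trans (toℕ-shift 0 e) (toℕ-%k e))

  shift-k : ∀ e → shift k e ≡ e
  shift-k e = toℕ-injective (begin
    toℕ (shift k e)   ≡⟨ toℕ-shift k e ⟩
    (k + toℕ e) % k   ≡⟨ cong (_% k) (+-comm k (toℕ e)) ⟩
    (toℕ e + k) % k   ≡⟨ [m+n]%n≡m%n (toℕ e) k ⟩
    toℕ e % k         ≡⟨ toℕ-%k e ⟩
    toℕ e             ∎)
    where open ≡-Reasoning

  shift-zero : ∀ e → shift (toℕ e) zero ≡ e
  shift-zero e = toℕ-injective (trans (toℕ-shift (toℕ e) zero)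
    (trans (cong (_% k) (+-identityʳ (toℕ e))) (toℕ-%k e)))

  power-shift : ∀ j t e → power j (shift t e) ≈ replicate t (j , true) ++ power j e
  power-shift j t e =
    ≈-trans (≡⇒≈ (cong (λ m → replicate m (j , true)) (toℕ-shift t e)))
      (≈-trans (≈-sym (replicate-% (t + toℕ e) j)) (≡⇒≈ (replicate-+ t (toℕ e) (j , true))))

  Tail : Fin (suc d) → Set
  Tail j = Σ (Maybe (Fin (suc d))) λ m → Cell d k m × Allowed d k m j

  tailNF : ∀ {j} → Tail j → NormalForm
  tailNF (m , c , _) = m , c

  -- x = α_j^e · r, where r does not start with an α_j-syllable (so e = 0 when x does not).
  splitSyllable : ∀ j {m} (c : Cell d k m) {i} → Allowed d k m i → Fin n → Dec (i ≡ j) →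
                  Fin k × Tail j
  splitSyllable j c ok a (yes refl)     = suc a , (_ , c , ok)
  splitSyllable j c {i} ok a (no i≢j) = zero , (just i , grow c i ok a , fromWitnessFalse i≢j)

  split : (j : Fin (suc d)) → NormalForm → Fin k × Tail j
  split j (_ , base)          = zero , (nothing , base , tt)
  split j (_ , grow c i ok a) = splitSyllable j c ok a (i ≟ j)

  join : (j : Fin (suc d)) → Fin k → Tail j → NormalForm
  join j zero    (m , c , _)  = m , c
  join j (suc a) (m , c , ok) = just j , grow c j ok a

  join-split : ∀ j x → join j (proj₁ (split j x)) (proj₂ (split j x)) ≡ x
  join-split j (_ , base) = refl
  join-split j (_ , grow c i ok a) with i ≟ j
  ... | yes refl = refl
  ... | no  _    = refl

  split-join : ∀ j e r → split j (join j e r) ≡ (e , r)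
  split-join j zero (_ , base , tt) = refl
  split-join j zero (_ , grow c i ok′ a , ok) = splitSyllable-no (i ≟ j)
    where
      splitSyllable-no : ∀ q → splitSyllable j c ok′ a q ≡ (zero , (_ , grow c i ok′ a , ok))
      splitSyllable-no (yes refl) = ⊥-elim (toWitnessFalse ok refl)
      splitSyllable-no (no _)     = cong (λ p → zero , (_ , grow c i ok′ a , p)) (T-irrelevant _ _)
  split-join j (suc a) r with j ≟ j
  ... | yes refl = refl
  ... | no  j≢j  = ⊥-elim (j≢j refl)

  word-join : ∀ j e r → word (join j e r) ≡ power j e ++ word (tailNF r)
  word-join j zero    r = refl
  word-join j (suc a) r = refl

  mulPower : Fin (suc d) → ℕ → NormalForm → NormalForm
  mulPower j t x = join j (shift t (proj₁ (split j x))) (proj₂ (split j x))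

  mulPower-join : ∀ j t e r → mulPower j t (join j e r) ≡ join j (shift t e) r
  mulPower-join j t e r = cong (λ p → join j (shift t (proj₁ p)) (proj₂ p)) (split-join j e r)

  mulPower-+ : ∀ j a b x → mulPower j a (mulPower j b x) ≡ mulPower j (a + b) x
  mulPower-+ j a b x = trans (mulPower-join j a (shift b e) r) (cong (λ e′ → join j e′ r) (shift-+ a b e))
    where
      e = proj₁ (split j x)
      r = proj₂ (split j x)

  mulPower-id : ∀ j t x → shift t (proj₁ (split j x)) ≡ proj₁ (split j x) → mulPower j t x ≡ x
  mulPower-id j t x eq = trans (cong (λ e → join j e (proj₂ (split j x))) eq) (join-split j x)

  mulPower-0 : ∀ j x → mulPower j 0 x ≡ x
  mulPower-0 j x = mulPower-id j 0 x (shift-0 _)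

  mulPower-k : ∀ j x → mulPower j k x ≡ x
  mulPower-k j x = mulPower-id j k x (shift-k _)

  -- α_j⁻¹ acts as α_j^{k-1}.
  exponent : Bool → ℕ
  exponent true  = 1
  exponent false = n

  act : Word d k → NormalForm → NormalForm
  act []            x = x
  act ((j , b) ∷ w) x = mulPower j (exponent b) (act w x)

  act-++ : ∀ u v x → act (u ++ v) x ≡ act u (act v x)
  act-++ []      v x = refl
  act-++ (l ∷ u) v x = cong (mulPower (proj₁ l) (exponent (proj₂ l))) (act-++ u v x)

  act-replicate : ∀ j t x → act (replicate t (j , true)) x ≡ mulPower j t x
  act-replicate j zero    x = sym (mulPower-0 j x)
  act-replicate j (suc t) x = trans (cong (mulPower j 1) (act-replicate j t x)) (mulPower-+ j 1 t x)

  act-cancel : ∀ l x → act (l ∷ invL d k l ∷ []) x ≡ x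
  act-cancel (j , true)  x = trans (mulPower-+ j 1 n x) (mulPower-k j x)
  act-cancel (j , false) x =
    trans (mulPower-+ j n 1 x) (trans (cong (λ t → mulPower j t x) (+-comm n 1)) (mulPower-k j x))

  act-resp-≈ : ∀ {u v} → u ≈ v → ∀ x → act u x ≡ act v x
  act-resp-≈ ≈-refl          x = refl
  act-resp-≈ (≈-sym p)       x = sym (act-resp-≈ p x)
  act-resp-≈ (≈-trans p q)   x = trans (act-resp-≈ p x) (act-resp-≈ q x)
  act-resp-≈ (≈-cancel u v l) x = begin
    act (u ++ l ∷ invL d k l ∷ v) x               ≡⟨ act-++ u _ x ⟩
    act u (act (l ∷ invL d k l ∷ []) (act v x))   ≡⟨ cong (act u) (act-cancel l (act v x)) ⟩
    act u (act v x)                               ≡⟨ act-++ u v x ⟨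
    act (u ++ v) x                                ∎
    where open ≡-Reasoning
  act-resp-≈ (≈-power u v i)  x = begin
    act (u ++ αᵏ ++ v) x            ≡⟨ act-++ u _ x ⟩
    act u (act (αᵏ ++ v) x)         ≡⟨ cong (act u) (act-++ αᵏ v x) ⟩
    act u (act αᵏ (act v x))        ≡⟨ cong (act u) (act-replicate i k (act v x)) ⟩
    act u (mulPower i k (act v x))  ≡⟨ cong (act u) (mulPower-k i (act v x)) ⟩
    act u (act v x)                 ≡⟨ act-++ u v x ⟨
    act (u ++ v) x                  ∎
    where
      open ≡-Reasoning
      αᵏ = replicate k (i , true)

  inverse≈power : ∀ j w → (j , false) ∷ w ≈ replicate n (j , true) ++ w
  inverse≈power j w =
    ≈-trans (≈-sym (≈-power [ j , false ] w j)) (≈-cancel [] (replicate n (j , true) ++ w) (j , false))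

  word-mulPower : ∀ j t x → word (mulPower j t x) ≈ replicate t (j , true) ++ word x
  word-mulPower j t x = begin
    word (mulPower j t x)                        ≡⟨ word-join j (shift t e) r ⟩
    power j (shift t e) ++ word (tailNF r)       ≈⟨ ++-congʳ _ (power-shift j t e) ⟩
    (αᵗ ++ power j e) ++ word (tailNF r)         ≡⟨ ++-assoc αᵗ _ _ ⟩
    αᵗ ++ power j e ++ word (tailNF r)           ≡⟨ cong (αᵗ ++_) (word-join j e r) ⟨
    αᵗ ++ word (join j e r)                      ≡⟨ cong (λ y → αᵗ ++ word y) (join-split j x) ⟩
    αᵗ ++ word x                                 ∎
    where
      open ≈-Reasoning
      e = proj₁ (split j x)
      r = proj₂ (split j x)
      αᵗ = replicate t (j , true)

  word-act : ∀ w x → word (act w x) ≈ w ++ word x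
  word-act []            x = ≈-refl
  word-act ((j , b) ∷ w) x =
    ≈-trans (word-mulPower j (exponent b) (act w x))
      (≈-trans (++-congˡ (replicate (exponent b) (j , true)) (word-act w x)) (letter b))
    where
      letter : ∀ b → replicate (exponent b) (j , true) ++ w ++ word x ≈ (j , b) ∷ w ++ word x
      letter true  = ≈-refl
      letter false = ≈-sym (inverse≈power j (w ++ word x))

  nf : Word d k → NormalForm
  nf w = act w identity

  word-nf : ∀ w → word (nf w) ≈ w
  word-nf w = ≈-trans (word-act w identity) (≡⇒≈ (++-identityʳ w))

  nf-cellWord : ∀ {m} (c : Cell d k m) → nf (cellWord c) ≡ (m , c)
  nf-cellWord base                = refl
  nf-cellWord (grow {m} c j ok a) = begin
    nf (αᵉ ++ cellWord c)                          ≡⟨ act-++ αᵉ (cellWord c) identity ⟩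
    act αᵉ (nf (cellWord c))                       ≡⟨ cong (act αᵉ) (nf-cellWord c) ⟩
    act αᵉ (m , c)                                 ≡⟨ act-replicate j (toℕ (suc a)) (m , c) ⟩
    mulPower j (toℕ (suc a)) (join j zero r)       ≡⟨ mulPower-join j (toℕ (suc a)) zero r ⟩
    join j (shift (toℕ (suc a)) zero) r            ≡⟨ cong (λ e → join j e r) (shift-zero (suc a)) ⟩
    join j (suc a) r                               ∎
    where
      open ≡-Reasoning
      αᵉ = replicate (suc (toℕ a)) (j , true)
      r : Tail j
      r = m , c , ok

  word-injective : ∀ x y → word x ≡ word y → x ≡ y
  word-injective (_ , c) (_ , c′) eq = trans (sym (nf-cellWord c)) (trans (cong nf eq) (nf-cellWord c′))

module Cosets (d n : ℕ) where

  open NormalForms d n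
  open Presentation d k

  -- The suffix of the reduced word c starting at its first α_i-syllable; it determines K_î c.
  suffixCell : Fin (suc d) → ∀ {m} → Cell d k m → NormalForm
  suffixCell i base = identity
  suffixCell i (grow c j ok a) with i ≟ j
  ... | yes _ = just j , grow c j ok a
  ... | no  _ = suffixCell i c

  suffix : Fin (suc d) → NormalForm → NormalForm
  suffix i (_ , c) = suffixCell i c

  suffixCell-grow : ∀ i {m} (c : Cell d k m) ok a → suffixCell i (grow c i ok a) ≡ (just i , grow c i ok a)
  suffixCell-grow i c ok a with i ≟ i
  ... | yes _   = refl
  ... | no  i≢i = ⊥-elim (i≢i refl)

  suffix-suffixCell : ∀ i {m} (c : Cell d k m) → suffix i (suffixCell i c) ≡ suffixCell i c
  suffix-suffixCell i base = refl
  suffix-suffixCell i (grow c j ok a) with i ≟ j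
  ... | yes refl = suffixCell-grow i c ok a
  ... | no  _    = suffix-suffixCell i c

  suffix-join : ∀ i j → ¬ j ≡ i → ∀ e r → suffix i (join j e r) ≡ suffix i (tailNF r)
  suffix-join i j j≢i zero    r = refl
  suffix-join i j j≢i (suc a) r with i ≟ j
  ... | yes i≡j = ⊥-elim (j≢i (sym i≡j))
  ... | no  _   = refl

  suffix-mulPower : ∀ i j → ¬ j ≡ i → ∀ t x → suffix i (mulPower j t x) ≡ suffix i x
  suffix-mulPower i j j≢i t x = begin
    suffix i (mulPower j t x)  ≡⟨ suffix-join i j j≢i (shift t e) r ⟩
    suffix i (tailNF r)        ≡⟨ suffix-join i j j≢i e r ⟨
    suffix i (join j e r)      ≡⟨ cong (suffix i) (join-split j x) ⟩
    suffix i x                 ∎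
    where
      open ≡-Reasoning
      e = proj₁ (split j x)
      r = proj₂ (split j x)

  suffix-act : ∀ i {w} → Avoids i w → ∀ x → suffix i (act w x) ≡ suffix i x
  suffix-act i []         x = refl
  suffix-act i {(j , b) ∷ w} (j≢i ∷ ps) x =
    trans (suffix-mulPower i j j≢i (exponent b) (act w x)) (suffix-act i ps x)

  cellWord-factor : ∀ i {m} (c : Cell d k m) →
                    Σ (Word d k) λ p → Avoids i p × cellWord c ≡ p ++ word (suffixCell i c)
  cellWord-factor i base = [] , [] , refl
  cellWord-factor i (grow c j ok a) with i ≟ j
  ... | yes _   = [] , [] , refl
  ... | no  i≢j with cellWord-factor i c
  ... | p , avoids , eq =
    αᵉ ++ p , All.++⁺ (All.replicate⁺ (suc (toℕ a)) (λ j≡i → i≢j (sym j≡i))) avoids ,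
    trans (cong (αᵉ ++_) eq) (sym (++-assoc αᵉ p _))
    where αᵉ = replicate (suc (toℕ a)) (j , true)

  suffix-factor : ∀ i g → Σ (Word d k) λ p → Avoids i p × g ≈ p ++ word (suffix i (nf g))
  suffix-factor i g with cellWord-factor i (proj₂ (nf g))
  ... | p , avoids , eq = p , avoids , ≈-trans (≈-sym (word-nf g)) (≡⇒≈ eq)

  suffix≡⇒coset⊆ : ∀ i g g′ → suffix i (nf g) ≡ suffix i (nf g′) →
                   ∀ x → InCoset d k i g x → InCoset d k i g′ x
  suffix≡⇒coset⊆ i g g′ eq x (h , (w , avoids-w , w≈h) , x≈hg)
    with suffix-factor i g | suffix-factor i g′
  ... | p , avoids-p , g≈ps | p′ , avoids-p′ , g′≈p′s′ =
    w ++ q , (w ++ q , All.++⁺ avoids-w avoids-q , ≈-refl) , x≈wqg′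
    where
      q = p ++ invW d k p′
      avoids-q : Avoids i q
      avoids-q = All.++⁺ avoids-p (Avoids-invW avoids-p′)
      g≈qg′ : g ≈ q ++ g′
      g≈qg′ = ≈-rebase p p′ g≈ps (subst (λ y → g′ ≈ p′ ++ word y) (sym eq) g′≈p′s′)
      x≈wqg′ : x ≈ (w ++ q) ++ g′
      x≈wqg′ = ≈-trans x≈hg (≈-trans (++-congʳ g (≈-sym w≈h))
                 (≈-trans (++-congˡ w g≈qg′) (≡⇒≈ (sym (++-assoc w q g′)))))

  suffix≡⇒sameCoset : ∀ i g g′ → suffix i (nf g) ≡ suffix i (nf g′) → SameCoset d k i g g′
  suffix≡⇒sameCoset i g g′ eq x =
    suffix≡⇒coset⊆ i g g′ eq x , suffix≡⇒coset⊆ i g′ g (sym eq) x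

  sameCoset⇒suffix≡ : ∀ i g g′ → SameCoset d k i g g′ → suffix i (nf g) ≡ suffix i (nf g′)
  sameCoset⇒suffix≡ i g g′ same with proj₁ (same g) ([] , ([] , [] , ≈-refl) , ≈-refl)
  ... | h , (w , avoids , w≈h) , g≈hg′ = begin
    suffix i (nf g)           ≡⟨ cong (suffix i) (act-resp-≈ g≈wg′ identity) ⟩
    suffix i (nf (w ++ g′))   ≡⟨ cong (suffix i) (act-++ w g′ identity) ⟩
    suffix i (act w (nf g′))  ≡⟨ suffix-act i avoids (nf g′) ⟩
    suffix i (nf g′)          ∎
    where
      open ≡-Reasoning
      g≈wg′ : g ≈ w ++ g′
      g≈wg′ = ≈-trans g≈hg′ (++-congʳ g′ (≈-sym w≈h))

module Nerve (d n : ℕ) where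

  open NormalForms d n
  open Cosets d n

  vertex : Fin (suc d) → NormalForm → TV d k
  vertex i (_ , base)          = root i
  vertex i (_ , grow c j ok a) = new c j ok a

  vertexAt≡vertex-suffix : ∀ {m} (c : Cell d k m) p → vertexAt d k c p ≡ vertex p (suffixCell p c)
  vertexAt≡vertex-suffix base            p = refl
  vertexAt≡vertex-suffix (grow c j ok a) p with p ≟ j
  ... | yes refl = refl
  ... | no  _    = vertexAt≡vertex-suffix c p

  toCoset : TV d k → M0 d k
  toCoset (root p)       = p , []
  toCoset (new c j ok a) = j , cellWord (grow c j ok a)

  toCoset-vertex-suffix : ∀ i {m} (c : Cell d k m) →
                          toCoset (vertex i (suffixCell i c)) ≡ (i , word (suffixCell i c))
  toCoset-vertex-suffix i base = refl
  toCoset-vertex-suffix i (grow c j ok a) with i ≟ j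
  ... | yes refl = refl
  ... | no  _    = toCoset-vertex-suffix i c

  vertex-suffix-injective : ∀ p i {m m′} (c : Cell d k m) (c′ : Cell d k m′) →
                            vertex p (suffixCell p c) ≡ vertex i (suffixCell i c′) →
                            suffixCell i c ≡ suffixCell i c′
  vertex-suffix-injective p i c c′ eq
    with refl , words≡ ← ,-injective (trans (sym (toCoset-vertex-suffix p c))
                                     (trans (cong toCoset eq) (toCoset-vertex-suffix i c′)))
    = word-injective _ _ words≡

  toVertex : M0 d k → TV d k
  toVertex (i , g) = vertex i (suffix i (nf g))

  toVertex-resp : ∀ {u v} → _≈M_ d k u v → toVertex u ≡ toVertex v
  toVertex-resp {i , g} {_ , g′} (refl , same) = cong (vertex i) (sameCoset⇒suffix≡ i g g′ same)

  toVertex-toCoset : ∀ t → toVertex (toCoset t) ≡ t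
  toVertex-toCoset (root p)        = refl
  toVertex-toCoset (new c j ok a) =
    cong (vertex j) (trans (cong (suffix j) (nf-cellWord (grow c j ok a))) (suffixCell-grow j c ok a))

  toCoset-toVertex : ∀ v → _≈M_ d k (toCoset (toVertex v)) v
  toCoset-toVertex (i , g) =
    subst (λ u → _≈M_ d k u (i , g)) (sym (toCoset-vertex-suffix i (proj₂ (nf g))))
      (refl , suffix≡⇒sameCoset i _ g
                (trans (cong (suffix i) (nf-cellWord (proj₂ x))) (suffix-suffixCell i (proj₂ (nf g)))))
    where x = suffixCell i (proj₂ (nf g))

  coset∋⇒vertexAt : ∀ g′ v → A d k v g′ →
                    Σ (Fin (suc d)) λ p → vertexAt d k (proj₂ (nf g′)) p ≡ toVertex v
  coset∋⇒vertexAt g′ (i , g) same =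
    i , trans (vertexAt≡vertex-suffix (proj₂ (nf g′)) i)
              (cong (vertex i) (sym (sameCoset⇒suffix≡ i g g′ same)))

  vertexAt⇒coset∋ : ∀ {m} (c : Cell d k m) v →
                    (Σ (Fin (suc d)) λ p → vertexAt d k c p ≡ toVertex v) → A d k v (cellWord c)
  vertexAt⇒coset∋ c (i , g) (p , eq) =
    suffix≡⇒sameCoset i g (cellWord c) (sym (trans (cong (suffix i) (nf-cellWord c))
      (vertex-suffix-injective p i c (proj₂ (nf g)) (trans (sym (vertexAt≡vertex-suffix c p)) eq))))

  nerveCell⇒TCell : ∀ σ → NerveCell d k σ → TCell d k (map toVertex σ)
  nerveCell⇒TCell σ (g′ , cosets) =
    _ , proj₂ (nf g′) , All.map⁺ (All.map (λ {v} → coset∋⇒vertexAt g′ v) cosets)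

  TCell⇒nerveCell : ∀ σ → TCell d k (map toVertex σ) → NerveCell d k σ
  TCell⇒nerveCell σ (_ , c , vertices) =
    cellWord c , All.map (λ {v} → vertexAt⇒coset∋ c v) (All.map⁻ vertices)

  isomorphism : NerveIsoT d k
  isomorphism = record
    { to         = toVertex
    ; from       = toCoset
    ; to-resp    = λ {u} {v} → toVertex-resp {u} {v}
    ; to-from    = toVertex-toCoset
    ; from-to    = toCoset-toVertex
    ; cells-to   = nerveCell⇒TCell
    ; cells-from = TCell⇒nerveCell
    }

module Dimension (d k : ℕ) where

  sameType⇒≈M : ∀ g′ u v → A d k u g′ → A d k v g′ → proj₁ u ≡ proj₁ v → _≈M_ d k u v
  sameType⇒≈M g′ (i , g) (_ , h) g∼g′ h∼g′ refl =
    refl , λ x → (λ x∈ → proj₂ (h∼g′ x) (proj₁ (g∼g′ x) x∈)) ,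
                 (λ x∈ → proj₂ (g∼g′ x) (proj₁ (h∼g′ x) x∈))

  types-unique : ∀ g′ σ → All (λ v → A d k v g′) σ → DistinctM d k σ → Unique (map proj₁ σ)
  types-unique g′ []      []        []          = []
  types-unique g′ (u ∷ σ) (u∼ ∷ σ∼) (u≉ ∷ σ≉) =
    All.map⁺ (All.zipWith (λ (v∼ , u≉v) eq → u≉v (sameType⇒≈M g′ u _ u∼ v∼ eq)) (σ∼ , u≉))
      ∷ types-unique g′ σ σ∼ σ≉

  nerveCell-length≤ : ∀ σ → NerveCell d k σ → DistinctM d k σ → length σ ≤ suc d
  nerveCell-length≤ σ (g′ , cosets) distinct =
    subst (_≤ suc d) (length-map proj₁ σ) (Unique⇒length≤ (types-unique g′ σ cosets distinct))

  identityCosets : List (M0 d k)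
  identityCosets = map (λ i → i , []) (allFin (suc d))

  identityCosets-nerveCell : NerveCell d k identityCosets
  identityCosets-nerveCell =
    [] , All.map⁺ (All.universal (λ _ _ → (λ x∈ → x∈) , (λ x∈ → x∈)) (allFin (suc d)))

  identityCosets-distinct : DistinctM d k identityCosets
  identityCosets-distinct =
    AllPairs.map⁺ (AllPairs.map (λ i≢j same → i≢j (proj₁ same)) (allFin⁺ (suc d)))

  length-identityCosets : length identityCosets ≡ suc d
  length-identityCosets = trans (length-map _ (allFin (suc d))) (length-tabulate (λ i → i))

  dimension : NerveIsDDim d k
  dimension = nerveCell-length≤ ,
              (identityCosets , identityCosets-nerveCell , identityCosets-distinct , length-identityCosets)

theorem6p3 : (d k : ℕ) → 1 ≤ d → 1 ≤ k → NerveIsDDim d k × NerveIsoT d k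
theorem6p3 d zero    _ ()
theorem6p3 d (suc n) _ _ = Dimension.dimension d (suc n) , Nerve.isomorphism d n
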